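{- Let $\lambda$ be a JS-partition of type $\alpha$ with residue symbol $R_p(\lambda)=\left\{\begin{smallmatrix}x_1&\cdots&x_m\\ y_1&\cdots&y_m\end{smallmatrix}\right\}$ (entries in $\mathbb{Z}/p\mathbb{Z}$). If $l<k$, the columns $l$ and $k$ are regular and all columns strictly between them are singular, then $(x_k,y_k)=(\alpha+1-y_l,\ y_l-1)=(x_l+1,\ \alpha-(x_l+1))$ or $(x_k,y_k)=(y_l-1,\ \alpha+1-y_l)$. Moreover, if $R_p(\lambda)$ starts with singular columns, then its first regular column is $(x,y)=(\alpha,0)$ or $(0,\alpha)$.
   Context: Fix an integer $p\ge 2$. A partition is written $\lambda=(l_1^{a_1},\dots,l_t^{a_t})$ with $l_1>\dots>l_t>0$, $a_i\ge1$; it is $p$-regular if all $a_i\le p-1$. A $p$-regular $\lambda$ is a JS-partition if $l_i-l_{i+1}+a_i+a_{i+1}\equiv 0\pmod p$ for $1\le i<t$; its type is $l_1-a_1 \bmod p$. Residue symbol: the rim of $\lambda$ is the set of nodes $(i,j)$ of the Young diagram with $(i+1,j+1)$ not in it, ordered from the end of the first row to the start of the last row. The $p$-rim is the union of $p$-segments: the first consists of the first $p$ nodes of the rim (or all of it), each next one consists of the first $p$ (or all remaining) rim nodes starting at the last node of the row just below the lowest row of the previous segment, until the last row is reached. Let $a_1$ = size of the $p$-rim of $\lambda^{(1)}=\lambda$, $r_1$ = its number of parts; removing the $p$-rim gives $\lambda^{(2)}$; iterate until $\lambda^{(m+1)}=\emptyset$, defining $a_j,r_j$ for $\lambda^{(j)}$.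 The residue symbol $R_p(\lambda)$ has columns $(x_j,y_j)$, $j=1,\dots,m$, with $x_j\equiv a_{m+1-j}-r_{m+1-j}$, $y_j\equiv 1-r_{m+1-j}\pmod p$. A column is singular if $y_j=x_j+1$ (equivalently $p\mid a_{m+1-j}$), regular otherwise. -}

module Defs where

open import Data.Nat as ℕ using (ℕ; zero; suc; _+_; _∸_; _≤_; _<_; _⊔_; _≤?_)
open import Data.Nat.Divisibility as ℕD using ()
open import Data.Integer as ℤ using (ℤ; +_)
open import Data.Integer.Divisibility as ℤD using ()
open import Data.Product using (_×_; _,_; proj₁; proj₂)
open import Data.Nat.ListAction using (sum)
open import Data.List using (List; []; _∷_; length; reverse; map; zipWith; filter; replicate; concatMap)
open import Data.List.Relation.Unary.All using (All)
open import Data.List.Relation.Unary.Linked using (Linked)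
open import Relation.Nullary using (yes; no; ¬_)

-- Partitions in exponent form  (l₁^a₁, …, l_t^a_t) as a list of pairs (lᵢ , aᵢ)

IsPartitionExp : List (ℕ × ℕ) → Set
IsPartitionExp λ′ =
  All (λ la → 1 ≤ proj₁ la × 1 ≤ proj₂ la) λ′ ×
  Linked (λ la lb → proj₁ lb < proj₁ la) λ′

parts : List (ℕ × ℕ) → List ℕ
parts = concatMap (λ la → replicate (proj₂ la) (proj₁ la))

IsPRegular : ℕ → List (ℕ × ℕ) → Set
IsPRegular p = All (λ la → proj₂ la ≤ p ∸ 1)

IsJS : ℕ → List (ℕ × ℕ) → Set
IsJS p λ′ = IsPRegular p λ′ ×
  Linked (λ la lb → p ℕD.∣ ((proj₁ la ∸ proj₁ lb) + proj₂ la + proj₂ lb)) λ′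

-- type of a (nonempty) JS-partition with first block l₁^a₁ : l₁ - a₁ (as an integer, read mod p)
jsType : ℕ → ℕ → ℤ
jsType l₁ a₁ = + l₁ ℤ.- + a₁

-- number of rim nodes in a row of length x whose following rows are `rest`:
-- columns max(1, next) … x, where next is the length of the row below (0 if none)
rimCount : ℕ → List ℕ → ℕ
rimCount x []      = x
rimCount x (y ∷ _) = suc (x ∸ (1 ⊔ y))

-- segCounts p b rows : number of p-rim nodes in each row, where b is the
-- remaining budget of the current p-segment.  A segment ending in row i
-- is followed by a new segment (budget p) starting at the last node of row i+1;
-- the process stops when the last row is reached.
segCounts : ℕ → ℕ → List ℕ → List ℕ
segCounts p b []         = []
segCounts p b (x ∷ rest) with b ≤? rimCount x rest
... | yes _ = b ∷ segCounts p p rest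
... | no  _ = rimCount x rest ∷ segCounts p (b ∸ rimCount x rest) rest

pRimSize : ℕ → List ℕ → ℕ
pRimSize p μ = sum (segCounts p p μ)

-- remove the p-rim (the c rightmost nodes of a row are removed when c rim nodes lie in it);
-- empty rows are discarded
removePRim : ℕ → List ℕ → List ℕ
removePRim p μ = filter (1 ≤?_) (zipWith _∸_ μ (segCounts p p μ))

-- the pairs (a_j , r_j), j = 1 … m, with fuel (each step removes ≥ 1 node,
-- so fuel = |λ| suffices)
mullineuxPairs : ℕ → ℕ → List ℕ → List (ℕ × ℕ)
mullineuxPairs zero     p μ = []
mullineuxPairs (suc n)  p [] = []
mullineuxPairs (suc n)  p (x ∷ μ) =
  (pRimSize p (x ∷ μ) , length (x ∷ μ)) ∷ mullineuxPairs n p (removePRim p (x ∷ μ))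

-- residue symbol R_p(λ): list of columns (x_j , y_j), j = 1 … m, as integers
-- (to be read modulo p); column j comes from step m+1-j:
-- x_j = a_{m+1-j} - r_{m+1-j},  y_j = 1 - r_{m+1-j}.
residueSymbol : ℕ → List ℕ → List (ℤ × ℤ)
residueSymbol p μ =
  map (λ ar → (+ proj₁ ar ℤ.- + proj₂ ar , + 1 ℤ.- + proj₂ ar))
      (reverse (mullineuxPairs (sum μ) p μ))

infix 4 _≡_[mod_]
_≡_[mod_] : ℤ → ℤ → ℕ → Set
a ≡ b [mod p ] = (+ p) ℤD.∣ (a ℤ.- b)

Singular : ℕ → ℤ × ℤ → Set
Singular p c = proj₂ c ≡ proj₁ c ℤ.+ + 1 [mod p ]

Regular : ℕ → ℤ × ℤ → Set
Regular p c = ¬ Singular p c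

{-# OPTIONS --safe #-}
-- Write λ = (l₁^a₁, …, l_t^a_t) and let g be the number of rows above a block (l , a). The JS
-- condition telescopes to l − a − 2g ≡ α (mod p) for every block, α the type. Under this invariant
-- every p-segment of the p-rim either ends strictly inside the last row of a block or covers exactly
-- two consecutive blocks (and then l − l′ + a + a′ = p), and what is left after removing the p-rim
-- satisfies the invariant again, with the same α. Counting, a step with rim size A and R rows before
-- and R′ rows after satisfies either p ∣ A and R ∼ R′, or A ≡ α + 2R − 1 and R − 1 ∼ R′, where ∼ is
-- equality modulo p up to the involution r ↦ −α − r. For the column (x , y) = (A − R , 1 − R) this
-- says: singular columns keep R up to ∼, and a regular column has x + y ≡ α and −y ∼ 1 − y₀, where y₀
-- is the y-entry of the previous regular column (1 if there is none). Unfolding ∼ gives both claims.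
module Submission where

open import Defs
open import Data.Nat as ℕ using (ℕ; zero; suc; _+_; _∸_; _≤_; _<_; _≤?_; z≤n; s≤s)
open import Data.Nat.Divisibility using (_∣_; divides; ∣-refl; ∣m∣n⇒∣m+n; ∣m+n∣m⇒∣n; ∣⇒≤)
import Data.Nat.Properties as ℕP
import Data.Nat.Tactic.RingSolver as ℕRing
open import Algebra.Properties.CommutativeSemigroup ℕP.+-commutativeSemigroup
  using () renaming (interchange to +-interchange)
open import Data.Integer as ℤ using (ℤ; +_)
import Data.Integer.Properties as ℤP
import Data.Integer.Divisibility.Signed as ℤ∣
open import Data.Integer.Tactic.RingSolver using (solve-∀)
open import Data.Fin as Fin using (Fin; toℕ)
open import Data.List using (List; []; _∷_; _++_; length; lookup; replicate; zipWith; filter; map; reverse)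
import Data.List.Properties as ListP
open import Data.List.Relation.Unary.All using (All; []; _∷_)
import Data.List.Relation.Unary.All.Properties as AllP
open import Data.List.Relation.Unary.Linked using ([-]; _∷_)
open import Data.Nat.ListAction using (sum)
open import Data.Product using (_×_; _,_; proj₁; proj₂)
open import Data.Sum using (_⊎_; inj₁; inj₂)
open import Data.Empty using (⊥-elim)
open import Function using (_∘_)
open import Relation.Nullary using (¬_; yes; no)
open import Relation.Binary.PropositionalEquality
  using (_≡_; refl; sym; trans; cong; cong₂; subst; module ≡-Reasoning)

m∸n≤o⇒m≤n+o : ∀ {m} n {o} → m ∸ n ≤ o → m ≤ n + o
m∸n≤o⇒m≤n+o {m} n m∸n≤o = ℕP.≤-trans (ℕP.m≤n+m∸n m n) (ℕP.+-monoʳ-≤ n m∸n≤o)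

m≤n∸1⇒m<n : ∀ {m n} → 1 ≤ n → m ≤ n ∸ 1 → m < n
m≤n∸1⇒m<n {n = suc _} _ m≤n∸1 = s≤s m≤n∸1

m+n≡o⇒o∸m≡n : ∀ m {n o} → m + n ≡ o → o ∸ m ≡ n
m+n≡o⇒o∸m≡n m {n} refl = ℕP.m+n∸m≡n m n

0<n<m⇒m∤n : ∀ {m n} → 0 < n → n < m → ¬ m ∣ n
0<n<m⇒m∤n 0<n n<m m∣n = ℕP.<⇒≱ n<m (∣⇒≤ ⦃ ℕ.>-nonZero 0<n ⦄ m∣n)

[1+m]∸n<m⊎≡0 : ∀ m {n} → 2 ≤ n → suc m ∸ n < m ⊎ suc m ∸ n ≡ 0
[1+m]∸n<m⊎≡0 zero    {suc (suc n)} _ = inj₂ refl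
[1+m]∸n<m⊎≡0 (suc m) {suc (suc n)} _ = inj₁ (s≤s (ℕP.m∸n≤m m n))
[1+m]∸n<m⊎≡0 _       {suc zero}    (s≤s ())

multiple<double⇒≡ : ∀ {m n} → m ∣ n → 0 < n → n < m + m → n ≡ m
multiple<double⇒≡ {m} (divides (suc zero) refl) _ _ = ℕP.+-identityʳ m
multiple<double⇒≡ {m} (divides (suc (suc q)) refl) _ n<m+m =
  ⊥-elim (ℕP.<⇒≱ n<m+m (ℕP.+-monoʳ-≤ m (ℕP.m≤m+n m (q ℕ.* m))))

pos-∸ : ∀ {m n} → n ≤ m → + (m ∸ n) ≡ + m ℤ.- + n
pos-∸ {m} {n} n≤m = sym (trans (ℤP.m-n≡m⊖n m n) (ℤP.⊖-≥ n≤m))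

replicate-++-∷ : ∀ {A : Set} k (x : A) xs → replicate k x ++ x ∷ xs ≡ x ∷ replicate k x ++ xs
replicate-++-∷ zero    x xs = refl
replicate-++-∷ (suc k) x xs = cong (x ∷_) (replicate-++-∷ k x xs)

sum-ones-++ : ∀ k xs → sum (replicate k 1 ++ xs) ≡ k + sum xs
sum-ones-++ zero    xs = refl
sum-ones-++ (suc k) xs = cong suc (sum-ones-++ k xs)

map-reverse-∷ : ∀ {A B : Set} (f : A → B) x xs → map f (reverse (x ∷ xs)) ≡ map f (reverse xs) ++ f x ∷ []
map-reverse-∷ f x xs = trans (cong (map f) (ListP.unfold-reverse x xs)) (ListP.map-++ f (reverse xs) (x ∷ []))

zipWith-∸-replicate : ∀ k x c xs cs →
  zipWith _∸_ (replicate (suc k) x ++ xs) (replicate k 1 ++ c ∷ cs) ≡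
  replicate k (x ∸ 1) ++ (x ∸ c) ∷ zipWith _∸_ xs cs
zipWith-∸-replicate zero    x c xs cs = refl
zipWith-∸-replicate (suc k) x c xs cs = cong ((x ∸ 1) ∷_) (zipWith-∸-replicate k x c xs cs)

rows : List (ℕ × ℕ) → ℕ
rows []            = 0
rows ((_ , a) ∷ B) = a + rows B

length-parts : ∀ B → length (parts B) ≡ rows B
length-parts []            = refl
length-parts ((l , a) ∷ B) =
  trans (ListP.length-++ (replicate a l)) (cong₂ _+_ (ListP.length-replicate a) (length-parts B))

dropEmpty : List (ℕ × ℕ) → List (ℕ × ℕ)
dropEmpty []                    = []
dropEmpty ((zero  , _)     ∷ B) = dropEmpty B
dropEmpty ((suc l , zero)  ∷ B) = dropEmpty B
dropEmpty ((suc l , suc a) ∷ B) = (suc l , suc a) ∷ dropEmpty B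

rows-dropEmpty : ∀ {l} a B → 1 ≤ l → rows (dropEmpty ((l , a) ∷ B)) ≡ a + rows (dropEmpty B)
rows-dropEmpty {suc l} zero    B _ = refl
rows-dropEmpty {suc l} (suc a) B _ = refl

filter-parts : ∀ B → filter (1 ≤?_) (parts B) ≡ parts (dropEmpty B)
filter-parts [] = refl
filter-parts ((zero , a) ∷ B) =
  trans (ListP.filter-++ (1 ≤?_) (replicate a 0) (parts B))
        (cong₂ _++_ (ListP.filter-none (1 ≤?_) (AllP.replicate⁺ a λ ())) (filter-parts B))
filter-parts ((suc l , zero) ∷ B) = filter-parts B
filter-parts ((suc l , suc a) ∷ B) =
  trans (ListP.filter-++ (1 ≤?_) (replicate (suc a) (suc l)) (parts B))
        (cong₂ _++_ (ListP.filter-all (1 ≤?_) (AllP.replicate⁺ (suc a) (s≤s z≤n))) (filter-parts B))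

-- The p-rim of a list of rows

rimCount-pos : ∀ {x} rest → 1 ≤ x → 1 ≤ rimCount x rest
rimCount-pos []      1≤x = 1≤x
rimCount-pos (_ ∷ _) _   = s≤s z≤n

segCounts-fits : ∀ p {b} x rest → b ≤ rimCount x rest → segCounts p b (x ∷ rest) ≡ b ∷ segCounts p p rest
segCounts-fits p {b} x rest b≤ with b ≤? rimCount x rest
... | yes _  = refl
... | no  b≰ = ⊥-elim (b≰ b≤)

segCounts-spills : ∀ p {b} x rest → ¬ b ≤ rimCount x rest →
  segCounts p b (x ∷ rest) ≡ rimCount x rest ∷ segCounts p (b ∸ rimCount x rest) rest
segCounts-spills p {b} x rest b≰ with b ≤? rimCount x rest
... | yes b≤ = ⊥-elim (b≰ b≤)
... | no  _  = refl

segCounts-replicate : ∀ p {b} k l rest → k < b →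
  segCounts p b (replicate (suc k) (suc l) ++ rest) ≡ replicate k 1 ++ segCounts p (b ∸ k) (suc l ∷ rest)
segCounts-replicate p zero l rest _ = refl
segCounts-replicate p {suc b} (suc k) l rest (s≤s k<b) = begin
  segCounts p (suc b) (suc l ∷ suc l ∷ ls)
    ≡⟨ segCounts-spills p (suc l) (suc l ∷ ls) (ℕP.<⇒≱ (s≤s 1≤b) ∘ subst (suc b ≤_) single) ⟩
  rimCount (suc l) (suc l ∷ ls) ∷ segCounts p (suc b ∸ rimCount (suc l) (suc l ∷ ls)) (suc l ∷ ls)
    ≡⟨ cong (λ c → c ∷ segCounts p (suc b ∸ c) (suc l ∷ ls)) single ⟩
  1 ∷ segCounts p b (suc l ∷ ls)
    ≡⟨ cong (1 ∷_) (segCounts-replicate p k l rest k<b) ⟩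
  1 ∷ replicate k 1 ++ segCounts p (b ∸ k) (suc l ∷ rest) ∎
  where
  open ≡-Reasoning
  ls : List ℕ
  ls = replicate k (suc l) ++ rest
  single : rimCount (suc l) (suc l ∷ ls) ≡ 1
  single = cong suc (ℕP.n∸n≡0 l)
  1≤b : 1 ≤ b
  1≤b = ℕP.≤-trans (s≤s z≤n) k<b

segCounts-replicate-exact : ∀ p k l rest →
  segCounts p (suc k) (replicate (suc k) (suc l) ++ rest) ≡ replicate k 1 ++ 1 ∷ segCounts p p rest
segCounts-replicate-exact p k l rest = begin
  segCounts p (suc k) (replicate (suc k) (suc l) ++ rest)
    ≡⟨ segCounts-replicate p k l rest ℕP.≤-refl ⟩
  replicate k 1 ++ segCounts p (suc k ∸ k) (suc l ∷ rest)
    ≡⟨ cong (λ b → replicate k 1 ++ segCounts p b (suc l ∷ rest)) (ℕP.m+n∸n≡m 1 k) ⟩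
  replicate k 1 ++ segCounts p 1 (suc l ∷ rest)
    ≡⟨ cong (replicate k 1 ++_) (segCounts-fits p (suc l) rest (rimCount-pos rest (s≤s z≤n))) ⟩
  replicate k 1 ++ 1 ∷ segCounts p p rest ∎
  where open ≡-Reasoning

rimCount≤ : ∀ {x} rest → 1 ≤ x → rimCount x rest ≤ x
rimCount≤ []                _ = ℕP.≤-refl
rimCount≤ {suc x} (y ∷ rest) _ = s≤s (ℕP.∸-monoʳ-≤ (suc x) (ℕP.m≤m⊔n 1 y))

sum-zipWith-∸-segCounts : ∀ p b xs → All (1 ≤_) xs →
  sum (zipWith _∸_ xs (segCounts p b xs)) + sum (segCounts p b xs) ≡ sum xs
sum-zipWith-∸-segCounts p b [] [] = refl
sum-zipWith-∸-segCounts p b (x ∷ rest) (1≤x ∷ pos) with b ≤? rimCount x rest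
... | yes b≤ = trans (+-interchange (x ∸ b) _ b _)
  (cong₂ _+_ (ℕP.m∸n+n≡m (ℕP.≤-trans b≤ (rimCount≤ rest 1≤x))) (sum-zipWith-∸-segCounts p p rest pos))
... | no _ = trans (+-interchange (x ∸ rimCount x rest) _ (rimCount x rest) _)
  (cong₂ _+_ (ℕP.m∸n+n≡m (rimCount≤ rest 1≤x)) (sum-zipWith-∸-segCounts p _ rest pos))

sum-filter-positive : ∀ xs → sum (filter (1 ≤?_) xs) ≡ sum xs
sum-filter-positive []           = refl
sum-filter-positive (zero  ∷ xs) = sum-filter-positive xs
sum-filter-positive (suc x ∷ xs) = cong (λ s → suc x + s) (sum-filter-positive xs)

removePRim-sum : ∀ p μ → All (1 ≤_) μ → sum (removePRim p μ) + pRimSize p μ ≡ sum μ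
removePRim-sum p μ pos =
  trans (cong (_+ pRimSize p μ) (sum-filter-positive (zipWith _∸_ μ (segCounts p p μ))))
        (sum-zipWith-∸-segCounts p p μ pos)

pRimSize-pos : ∀ p {x} rest → 1 ≤ p → 1 ≤ x → 1 ≤ pRimSize p (x ∷ rest)
pRimSize-pos p {x} rest 1≤p 1≤x with p ≤? rimCount x rest
... | yes _ = ℕP.≤-trans 1≤p (ℕP.m≤m+n p _)
... | no  _ = ℕP.≤-trans (rimCount-pos rest 1≤x) (ℕP.m≤m+n (rimCount x rest) _)

removePRim-shrinks : ∀ p {x rest} → 1 ≤ p → All (1 ≤_) (x ∷ rest) →
  sum (removePRim p (x ∷ rest)) < sum (x ∷ rest)
removePRim-shrinks p {x} {rest} 1≤p pos@(1≤x ∷ _) =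
  subst (sum (removePRim p (x ∷ rest)) <_) (removePRim-sum p (x ∷ rest) pos)
        (ℕP.m<m+n _ (pRimSize-pos p rest 1≤p 1≤x))

module Congruence (p : ℕ) where

  p∣_ : ℤ → Set
  p∣ x = + p ℤ∣.∣ x

  infix 4 _≋_
  _≋_ : ℤ → ℤ → Set
  x ≋ y = p∣ (x ℤ.- y)

  p∣0 : p∣ (+ 0)
  p∣0 = ℤ∣.divides (+ 0) refl

  p∣p : p∣ (+ p)
  p∣p = ℤ∣.∣-refl

  p∣-≡ : ∀ {x y} → x ≡ y → p∣ y → p∣ x
  p∣-≡ refl p∣y = p∣y

  p∣-neg : ∀ {x z} → z ≡ ℤ.- x → p∣ x → p∣ z
  p∣-neg z≡-x p∣x = p∣-≡ z≡-x (ℤ∣.∣m⇒∣-m p∣x)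

  p∣-sum : ∀ {x y z} → z ≡ x ℤ.+ y → p∣ x → p∣ y → p∣ z
  p∣-sum z≡x+y p∣x p∣y = p∣-≡ z≡x+y (ℤ∣.∣m∣n⇒∣m+n p∣x p∣y)

  p∣-diff : ∀ {x y z} → z ≡ x ℤ.- y → p∣ x → p∣ y → p∣ z
  p∣-diff z≡x-y p∣x p∣y = p∣-≡ z≡x-y (ℤ∣.∣m∣n⇒∣m-n p∣x p∣y)

  ≋-reflexive : ∀ {x y} → x ≡ y → x ≋ y
  ≋-reflexive {x} refl = p∣-≡ (ℤP.+-inverseʳ x) p∣0

-- Residue symbols as chains of regular columns

residueColumn : ℕ × ℕ → ℤ × ℤ
residueColumn (A , R) = + A ℤ.- + R , + 1 ℤ.- + R

∣defect∣-residueColumn : ∀ A R →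
  ℤ.∣ proj₂ (residueColumn (A , R)) ℤ.- (proj₁ (residueColumn (A , R)) ℤ.+ + 1) ∣ ≡ A
∣defect∣-residueColumn A R = trans (cong ℤ.∣_∣ (defect (+ A) (+ R))) (ℤP.∣-i∣≡∣i∣ (+ A))
  where
  defect : ∀ a r → (+ 1 ℤ.- r) ℤ.- ((a ℤ.- r) ℤ.+ + 1) ≡ ℤ.- a
  defect = solve-∀

singular-residueColumn : ∀ {p} A R → p ∣ A → Singular p (residueColumn (A , R))
singular-residueColumn {p} A R = subst (p ∣_) (sym (∣defect∣-residueColumn A R))

regular-residueColumn : ∀ {p} A R → ¬ p ∣ A → Regular p (residueColumn (A , R))
regular-residueColumn {p} A R p∤A = p∤A ∘ subst (p ∣_) (∣defect∣-residueColumn A R)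

module ResidueChains (p : ℕ) (α : ℤ) where
  open Congruence p

  infix 4 _∼_
  data _∼_ (x y : ℤ) : Set where
    equal    : x ≋ y → x ∼ y
    mirrored : x ℤ.+ y ≋ ℤ.- α → x ∼ y

  ∼-reflexive : ∀ {x y} → x ≡ y → x ∼ y
  ∼-reflexive = equal ∘ ≋-reflexive

  ∼-sym : ∀ {x y} → x ∼ y → y ∼ x
  ∼-sym {x} {y} (equal x≋y) = equal (p∣-neg (swap x y) x≋y)
    where
    swap : ∀ x y → y ℤ.- x ≡ ℤ.- (x ℤ.- y)
    swap = solve-∀
  ∼-sym {x} {y} (mirrored x+y≋) = mirrored (p∣-≡ (swap x y α) x+y≋)
    where
    swap : ∀ x y α → (y ℤ.+ x) ℤ.- ℤ.- α ≡ (x ℤ.+ y) ℤ.- ℤ.- α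
    swap = solve-∀

  ∼-trans : ∀ {x y z} → x ∼ y → y ∼ z → x ∼ z
  ∼-trans {x} {y} {z} (equal x≋y) (equal y≋z) = equal (p∣-sum (split x y z) x≋y y≋z)
    where
    split : ∀ x y z → x ℤ.- z ≡ (x ℤ.- y) ℤ.+ (y ℤ.- z)
    split = solve-∀
  ∼-trans {x} {y} {z} (equal x≋y) (mirrored y+z≋) = mirrored (p∣-sum (split x y z α) x≋y y+z≋)
    where
    split : ∀ x y z α → (x ℤ.+ z) ℤ.- ℤ.- α ≡ (x ℤ.- y) ℤ.+ ((y ℤ.+ z) ℤ.- ℤ.- α)
    split = solve-∀
  ∼-trans {x} {y} {z} (mirrored x+y≋) (equal y≋z) = mirrored (p∣-diff (split x y z α) x+y≋ y≋z)
    where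
    split : ∀ x y z α → (x ℤ.+ z) ℤ.- ℤ.- α ≡ ((x ℤ.+ y) ℤ.- ℤ.- α) ℤ.- (y ℤ.- z)
    split = solve-∀
  ∼-trans {x} {y} {z} (mirrored x+y≋) (mirrored y+z≋) = equal (p∣-diff (split x y z α) x+y≋ y+z≋)
    where
    split : ∀ x y z α → x ℤ.- z ≡ ((x ℤ.+ y) ℤ.- ℤ.- α) ℤ.- ((y ℤ.+ z) ℤ.- ℤ.- α)
    split = solve-∀

  Follows : ℤ → ℤ × ℤ → Set
  Follows y c = proj₁ c ℤ.+ proj₂ c ≋ α × ℤ.- proj₂ c ∼ + 1 ℤ.- y

  -- In Chain y cs y′, y is the y-entry of the regular column preceding cs (1 if there is none)
  -- and y′ that of the last regular column of cs.
  data Chain : ℤ → List (ℤ × ℤ) → ℤ → Set where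
    []       : ∀ {y} → Chain y [] y
    singular : ∀ {y c cs y′} → Singular p c → Chain y cs y′ → Chain y (c ∷ cs) y′
    regular  : ∀ {y c cs y′} → Regular p c → Follows y c → Chain (proj₂ c) cs y′ → Chain y (c ∷ cs) y′

  Chain-++ : ∀ {y y′ y″ cs ds} → Chain y cs y′ → Chain y′ ds y″ → Chain y (cs ++ ds) y″
  Chain-++ []                 ds = ds
  Chain-++ (singular s cs)    ds = singular s (Chain-++ cs ds)
  Chain-++ (regular r f cs)   ds = regular r f (Chain-++ cs ds)

  regular-column-sum : ∀ {y cs y′} → Chain y cs y′ → (i : Fin (length cs)) → Regular p (lookup cs i) →
    proj₁ (lookup cs i) ℤ.+ proj₂ (lookup cs i) ≋ α
  regular-column-sum (singular s _)  Fin.zero    r = ⊥-elim (r s)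
  regular-column-sum (regular _ f _) Fin.zero    _ = proj₁ f
  regular-column-sum (singular _ cs) (Fin.suc i) r = regular-column-sum cs i r
  regular-column-sum (regular _ _ cs) (Fin.suc i) r = regular-column-sum cs i r

  first-regular-follows : ∀ {y cs y′} → Chain y cs y′ → (k : Fin (length cs)) →
    (∀ i → i Fin.< k → Singular p (lookup cs i)) → Regular p (lookup cs k) → Follows y (lookup cs k)
  first-regular-follows (singular s _)   Fin.zero    _      r = ⊥-elim (r s)
  first-regular-follows (regular _ f _)  Fin.zero    _      _ = f
  first-regular-follows (singular _ cs)  (Fin.suc k) before r =
    first-regular-follows cs k (λ i i<k → before (Fin.suc i) (s≤s i<k)) r
  first-regular-follows (regular r₀ _ _) (Fin.suc k) before _ = ⊥-elim (r₀ (before Fin.zero (s≤s z≤n)))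

  next-regular-follows : ∀ {y cs y′} → Chain y cs y′ → (l k : Fin (length cs)) → l Fin.< k →
    Regular p (lookup cs l) → Regular p (lookup cs k) →
    (∀ i → l Fin.< i → i Fin.< k → Singular p (lookup cs i)) → Follows (proj₂ (lookup cs l)) (lookup cs k)
  next-regular-follows (singular s _)   Fin.zero    _           _   rl _  _ = ⊥-elim (rl s)
  next-regular-follows (regular _ _ _)  Fin.zero    Fin.zero    ()  _  _  _
  next-regular-follows (regular _ _ cs) Fin.zero    (Fin.suc k) _   _  rk between =
    first-regular-follows cs k (λ i i<k → between (Fin.suc i) (s≤s z≤n) (s≤s i<k)) rk
  next-regular-follows (singular _ cs)  (Fin.suc l) (Fin.suc k) (s≤s l<k) rl rk between =
    next-regular-follows cs l k l<k rl rk (λ i l<i i<k → between (Fin.suc i) (s≤s l<i) (s≤s i<k))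
  next-regular-follows (regular _ _ cs) (Fin.suc l) (Fin.suc k) (s≤s l<k) rl rk between =
    next-regular-follows cs l k l<k rl rk (λ i l<i i<k → between (Fin.suc i) (s≤s l<i) (s≤s i<k))

  -- A partition with R rows loses its p-rim, of size A, and keeps R′ rows.
  data RimStep (R R′ A : ℕ) : Set where
    p∣size : p ∣ A → + R ∼ + R′ → RimStep R R′ A
    p∤size : ¬ p ∣ A → + A ≋ α ℤ.+ + R ℤ.+ + R ℤ.- + 1 → + R ℤ.- + 1 ∼ + R′ → RimStep R R′ A

  RimStep-cong : ∀ {R R′ A S S′ B} → R ≡ S → R′ ≡ S′ → A ≡ B → RimStep R R′ A → RimStep S S′ B
  RimStep-cong refl refl refl step = step

  RimStep-+p : ∀ {R R′ A} → RimStep R R′ A → RimStep R R′ (p + A)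
  RimStep-+p (p∣size p∣A R∼R′) = p∣size (∣m∣n⇒∣m+n ∣-refl p∣A) R∼R′
  RimStep-+p {R} {A = A} (p∤size p∤A A≋ R-1∼R′) =
    p∤size (λ p∣p+A → p∤A (∣m+n∣m⇒∣n p∣p+A ∣-refl))
           (p∣-sum (shift (+ p) (+ A) (α ℤ.+ + R ℤ.+ + R ℤ.- + 1)) p∣p A≋) R-1∼R′
    where
    shift : ∀ p a t → (p ℤ.+ a) ℤ.- t ≡ p ℤ.+ (a ℤ.- t)
    shift = solve-∀

  record ChainUpTo (cs : List (ℤ × ℤ)) (R : ℕ) : Set where
    constructor chainUpTo
    field
      {lastY} : ℤ
      chain   : Chain (+ 1) cs lastY
      rows∼   : + 1 ℤ.- lastY ∼ + R

  chain-extend : ∀ {cs R R′ A} → RimStep R R′ A → ChainUpTo cs R′ →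
    ChainUpTo (cs ++ residueColumn (A , R) ∷ []) R
  chain-extend {R = R} {A = A} (p∣size p∣A R∼R′) (chainUpTo chain y∼R′) =
    chainUpTo (Chain-++ chain (singular (singular-residueColumn A R p∣A) [])) (∼-trans y∼R′ (∼-sym R∼R′))
  chain-extend {R = R} {A = A} (p∤size p∤A A≋ R-1∼R′) (chainUpTo {y} chain y∼R′) =
    chainUpTo (Chain-++ chain (regular (regular-residueColumn A R p∤A) follows []))
              (∼-reflexive (involutive (+ R)))
    where
    involutive : ∀ r → + 1 ℤ.- (+ 1 ℤ.- r) ≡ r
    involutive = solve-∀
    column-sum : ∀ a r α → ((a ℤ.- r) ℤ.+ (+ 1 ℤ.- r)) ℤ.- α ≡ a ℤ.- (α ℤ.+ r ℤ.+ r ℤ.- + 1)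
    column-sum = solve-∀
    negated : ∀ r → ℤ.- (+ 1 ℤ.- r) ≡ r ℤ.- + 1
    negated = solve-∀
    follows : Follows y (residueColumn (A , R))
    follows = p∣-≡ (column-sum (+ A) (+ R) α) A≋
            , ∼-trans (∼-reflexive (negated (+ R))) (∼-trans R-1∼R′ (∼-sym y∼R′))

  consecutive-regular : ∀ cl ck → proj₁ cl ℤ.+ proj₂ cl ≋ α → Follows (proj₂ cl) ck →
    (proj₁ ck ≡ α ℤ.+ + 1 ℤ.- proj₂ cl [mod p ] × proj₂ ck ≡ proj₂ cl ℤ.- + 1 [mod p ]
      × proj₁ ck ≡ proj₁ cl ℤ.+ + 1 [mod p ] × proj₂ ck ≡ α ℤ.- (proj₁ cl ℤ.+ + 1) [mod p ])
    ⊎ (proj₁ ck ≡ proj₂ cl ℤ.- + 1 [mod p ] × proj₂ ck ≡ α ℤ.+ + 1 ℤ.- proj₂ cl [mod p ])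
  consecutive-regular (xl , yl) (xk , yk) sum-l (sum-k , equal yk≋) =
    inj₁ ( ℤ∣.∣⇒∣ᵤ (p∣-sum (shift₁ xk yk yl α) sum-k yk≋)
         , ℤ∣.∣⇒∣ᵤ (p∣-neg (shift₂ yk yl) yk≋)
         , ℤ∣.∣⇒∣ᵤ (p∣-diff (shift₃ xk yk xl yl α) (p∣-sum (shift₁ xk yk yl α) sum-k yk≋) sum-l)
         , ℤ∣.∣⇒∣ᵤ (p∣-diff (shift₄ yk xl yl α) sum-l yk≋) )
    where
    shift₁ : ∀ xk yk yl α → xk ℤ.- (α ℤ.+ + 1 ℤ.- yl) ≡ ((xk ℤ.+ yk) ℤ.- α) ℤ.+ (ℤ.- yk ℤ.- (+ 1 ℤ.- yl))
    shift₁ = solve-∀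
    shift₂ : ∀ yk yl → yk ℤ.- (yl ℤ.- + 1) ≡ ℤ.- (ℤ.- yk ℤ.- (+ 1 ℤ.- yl))
    shift₂ = solve-∀
    shift₃ : ∀ xk yk xl yl α → xk ℤ.- (xl ℤ.+ + 1) ≡ (xk ℤ.- (α ℤ.+ + 1 ℤ.- yl)) ℤ.- ((xl ℤ.+ yl) ℤ.- α)
    shift₃ = solve-∀
    shift₄ : ∀ yk xl yl α → yk ℤ.- (α ℤ.- (xl ℤ.+ + 1)) ≡ ((xl ℤ.+ yl) ℤ.- α) ℤ.- (ℤ.- yk ℤ.- (+ 1 ℤ.- yl))
    shift₄ = solve-∀
  consecutive-regular (xl , yl) (xk , yk) _ (sum-k , mirrored yk≋) =
    inj₂ ( ℤ∣.∣⇒∣ᵤ (p∣-sum (shift₁ xk yk yl α) sum-k yk≋)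
         , ℤ∣.∣⇒∣ᵤ (p∣-neg (shift₂ yk yl α) yk≋) )
    where
    shift₁ : ∀ xk yk yl α →
      xk ℤ.- (yl ℤ.- + 1) ≡ ((xk ℤ.+ yk) ℤ.- α) ℤ.+ ((ℤ.- yk ℤ.+ (+ 1 ℤ.- yl)) ℤ.- ℤ.- α)
    shift₁ = solve-∀
    shift₂ : ∀ yk yl α → yk ℤ.- (α ℤ.+ + 1 ℤ.- yl) ≡ ℤ.- ((ℤ.- yk ℤ.+ (+ 1 ℤ.- yl)) ℤ.- ℤ.- α)
    shift₂ = solve-∀

  first-regular : ∀ c → Follows (+ 1) c →
    (proj₁ c ≡ α [mod p ] × proj₂ c ≡ + 0 [mod p ]) ⊎ (proj₁ c ≡ + 0 [mod p ] × proj₂ c ≡ α [mod p ])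
  first-regular (x , y) (sum , equal y≋) =
    inj₁ (ℤ∣.∣⇒∣ᵤ (p∣-sum (shift₁ x y α) sum y≋) , ℤ∣.∣⇒∣ᵤ (p∣-neg (shift₂ y) y≋))
    where
    shift₁ : ∀ x y α → x ℤ.- α ≡ ((x ℤ.+ y) ℤ.- α) ℤ.+ (ℤ.- y ℤ.- (+ 1 ℤ.- + 1))
    shift₁ = solve-∀
    shift₂ : ∀ y → y ℤ.- + 0 ≡ ℤ.- (ℤ.- y ℤ.- (+ 1 ℤ.- + 1))
    shift₂ = solve-∀
  first-regular (x , y) (sum , mirrored y≋) =
    inj₂ (ℤ∣.∣⇒∣ᵤ (p∣-sum (shift₁ x y α) sum y≋) , ℤ∣.∣⇒∣ᵤ (p∣-neg (shift₂ y α) y≋))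
    where
    shift₁ : ∀ x y α → x ℤ.- + 0 ≡ ((x ℤ.+ y) ℤ.- α) ℤ.+ ((ℤ.- y ℤ.+ (+ 1 ℤ.- + 1)) ℤ.- ℤ.- α)
    shift₁ = solve-∀
    shift₂ : ∀ y α → y ℤ.- α ≡ ℤ.- ((ℤ.- y ℤ.+ (+ 1 ℤ.- + 1)) ℤ.- ℤ.- α)
    shift₂ = solve-∀

module RimOfJSBlocks (p : ℕ) (2≤p : 2 ≤ p) (α : ℤ) where
  open Congruence p
  open ResidueChains p α

  -- the block (l , a) lies below g rows
  HasType : ℕ → ℕ → ℕ → Set
  HasType g l a = + l ℤ.- + a ℤ.- (+ g ℤ.+ + g) ≋ α

  JS⇒HasType : ∀ {g l a l′ a′} → l′ ≤ l → HasType g l a → p ∣ (l ∸ l′) + a + a′ → HasType (g + a) l′ a′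
  JS⇒HasType {g} {l} {a} {l′} {a′} l′≤l type js =
    p∣-diff (telescope (+ l) (+ a) (+ g) (+ l′) (+ a′) α) type
            (subst (λ d → p∣ (d ℤ.+ + a ℤ.+ + a′)) (pos-∸ l′≤l) (ℤ∣.∣ᵤ⇒∣ js))
    where
    telescope : ∀ l a g l′ a′ α → (l′ ℤ.- a′ ℤ.- ((g ℤ.+ a) ℤ.+ (g ℤ.+ a))) ℤ.- α ≡
      ((l ℤ.- a ℤ.- (g ℤ.+ g)) ℤ.- α) ℤ.- ((l ℤ.- l′) ℤ.+ a ℤ.+ a′)
    telescope = solve-∀

  HasType⇒JS : ∀ {g l a l′ a′} → l′ ≤ l → HasType g l a → HasType (g + a) l′ a′ → p ∣ a + (l ∸ l′) + a′
  HasType⇒JS {g} {l} {a} {l′} {a′} l′≤l type type′ =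
    ℤ∣.∣⇒∣ᵤ (subst (λ d → p∣ (+ a ℤ.+ d ℤ.+ + a′)) (sym (pos-∸ l′≤l))
      (p∣-diff (telescope (+ l) (+ a) (+ g) (+ l′) (+ a′) α) type type′))
    where
    telescope : ∀ l a g l′ a′ α → a ℤ.+ (l ℤ.- l′) ℤ.+ a′ ≡
      ((l ℤ.- a ℤ.- (g ℤ.+ g)) ℤ.- α) ℤ.- ((l′ ℤ.- a′ ℤ.- ((g ℤ.+ a) ℤ.+ (g ℤ.+ a))) ℤ.- α)
    telescope = solve-∀

  HasType-shrink : ∀ {g l a} → HasType g (suc l) (suc a) → HasType g l a
  HasType-shrink {g} {l} {a} = p∣-≡ (shrink (+ l) (+ a) (+ g) α)
    where
    shrink : ∀ l a g α → (l ℤ.- a ℤ.- (g ℤ.+ g)) ℤ.- α ≡ ((+ 1 ℤ.+ l) ℤ.- (+ 1 ℤ.+ a) ℤ.- (g ℤ.+ g)) ℤ.- α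
    shrink = solve-∀

  HasType-split : ∀ {g l a} → a ≤ p → p ∸ a ≤ suc l → HasType g (suc l) (suc a) →
    HasType (g + a) (suc l ∸ (p ∸ a)) 1
  HasType-split {g} {l} {a} a≤p c≤l type =
    p∣-diff (trans (cong (λ m → (m ℤ.- + 1 ℤ.- (+ (g + a) ℤ.+ + (g + a))) ℤ.- α)
                         (trans (pos-∸ c≤l) (cong (λ c → + suc l ℤ.- c) (pos-∸ a≤p))))
                   (split (+ l) (+ a) (+ g) (+ p) α))
            type p∣p
    where
    split : ∀ l a g p α → ((+ 1 ℤ.+ l) ℤ.- (p ℤ.- a) ℤ.- + 1 ℤ.- ((g ℤ.+ a) ℤ.+ (g ℤ.+ a))) ℤ.- α ≡
      (((+ 1 ℤ.+ l) ℤ.- (+ 1 ℤ.+ a) ℤ.- (g ℤ.+ g)) ℤ.- α) ℤ.- p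
    split = solve-∀

  HasType-merge : ∀ {g a l′ a′} → HasType (g + suc a) (suc l′) (suc a′) → HasType (g + a) l′ (suc (suc a′))
  HasType-merge {g} {a} {l′} {a′} = p∣-≡ (merge (+ l′) (+ a′) (+ g) (+ a) α)
    where
    merge : ∀ l a g b α → (l ℤ.- (+ 2 ℤ.+ a) ℤ.- ((g ℤ.+ b) ℤ.+ (g ℤ.+ b))) ℤ.- α ≡
      ((+ 1 ℤ.+ l) ℤ.- (+ 1 ℤ.+ a) ℤ.- ((g ℤ.+ (+ 1 ℤ.+ b)) ℤ.+ (g ℤ.+ (+ 1 ℤ.+ b)))) ℤ.- α
    merge = solve-∀

  data JSBlocks : ℕ → ℕ → List (ℕ × ℕ) → Set where
    []   : ∀ {g u} → JSBlocks g u []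
    cons : ∀ {g u l a B} → l < u → 1 ≤ l → 1 ≤ a → a < p → HasType g l a →
           JSBlocks (g + a) l B → JSBlocks g u ((l , a) ∷ B)

  -- the shape produced by rimRemoved, where blocks may have length or multiplicity 0
  data WeakJSBlocks : ℕ → ℕ → List (ℕ × ℕ) → Set where
    []   : ∀ {g u} → WeakJSBlocks g u []
    cons : ∀ {g u l a B} → l < u ⊎ l ≡ 0 → (1 ≤ l → a < p × HasType g l a) →
           WeakJSBlocks (g + a) l B → WeakJSBlocks g u ((l , a) ∷ B)

  JSBlocks-ofJS : ∀ {l a B} → IsPartitionExp ((l , a) ∷ B) → IsJS p ((l , a) ∷ B) →
    + l ℤ.- + a ≋ α → JSBlocks 0 (suc l) ((l , a) ∷ B)
  JSBlocks-ofJS {l} {a} shape js l-a≋α =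
    fromJS ℕP.≤-refl (p∣-≡ (top (+ l ℤ.- + a) α) l-a≋α) shape js
    where
    top : ∀ t α → (t ℤ.- (+ 0 ℤ.+ + 0)) ℤ.- α ≡ t ℤ.- α
    top = solve-∀
    fromJS : ∀ {g u l a B} → l < u → HasType g l a →
      IsPartitionExp ((l , a) ∷ B) → IsJS p ((l , a) ∷ B) → JSBlocks g u ((l , a) ∷ B)
    fromJS {B = []} l<u type ((1≤l , 1≤a) ∷ [] , _) (a≤p-1 ∷ [] , _) =
      cons l<u 1≤l 1≤a (m≤n∸1⇒m<n (ℕP.≤-trans (s≤s z≤n) 2≤p) a≤p-1) type []
    fromJS {g} {B = _ ∷ _} l<u type ((1≤l , 1≤a) ∷ sizes , l′<l ∷ decreasing) (a≤p-1 ∷ multiplicities , js ∷ jss) =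
      cons l<u 1≤l 1≤a (m≤n∸1⇒m<n (ℕP.≤-trans (s≤s z≤n) 2≤p) a≤p-1) type
        (fromJS l′<l (JS⇒HasType {g} (ℕP.<⇒≤ l′<l) type js) (sizes , decreasing) (multiplicities , jss))

  JSBlocks-weaken : ∀ {g u u′ B} → u ≤ u′ → JSBlocks g u B → JSBlocks g u′ B
  JSBlocks-weaken _    []                         = []
  JSBlocks-weaken u≤u′ (cons l<u 1≤l 1≤a a<p t bs) = cons (ℕP.≤-trans l<u u≤u′) 1≤l 1≤a a<p t bs

  dropEmpty-below-1 : ∀ {g B} → WeakJSBlocks g 0 B → dropEmpty B ≡ []
  dropEmpty-below-1 []                          = refl
  dropEmpty-below-1 (cons (inj₁ ()) _ _)
  dropEmpty-below-1 (cons (inj₂ refl) _ bs) = dropEmpty-below-1 bs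

  dropEmpty-JSBlocks : ∀ {g u B} → WeakJSBlocks g u B → JSBlocks g u (dropEmpty B)
  dropEmpty-JSBlocks [] = []
  dropEmpty-JSBlocks (cons {l = zero} _ _ bs) = subst (JSBlocks _ _) (sym (dropEmpty-below-1 bs)) []
  dropEmpty-JSBlocks (cons {l = suc _} (inj₂ ()) _ _)
  dropEmpty-JSBlocks {g} (cons {l = suc _} {a = zero} (inj₁ l<u) _ bs) =
    subst (λ h → JSBlocks h _ _) (ℕP.+-identityʳ g) (JSBlocks-weaken (ℕP.<⇒≤ l<u) (dropEmpty-JSBlocks bs))
  dropEmpty-JSBlocks (cons {l = suc _} {a = suc _} (inj₁ l<u) typed bs) =
    cons l<u (s≤s z≤n) (s≤s z≤n) (proj₁ (typed (s≤s z≤n))) (proj₂ (typed (s≤s z≤n))) (dropEmpty-JSBlocks bs)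

  parts-positive : ∀ {g u B} → JSBlocks g u B → All (1 ≤_) (parts B)
  parts-positive []                           = []
  parts-positive (cons {a = a} _ 1≤l _ _ _ bs) = AllP.++⁺ (AllP.replicate⁺ a 1≤l) (parts-positive bs)

  headLength : List (ℕ × ℕ) → ℕ
  headLength []            = 0
  headLength ((l , _) ∷ _) = l

  headLength< : ∀ {g u B} → JSBlocks g (suc u) B → headLength B ≤ u
  headLength< []                     = z≤n
  headLength< (cons l<u _ _ _ _ _) = ℕP.≤-pred l<u

  -- Valid for JSBlocks only: there each p-segment ends strictly inside the last row of a block, or
  -- covers exactly that block and the next one (segment-overshoots, segment-spans-pair).
  rimCounts : List (ℕ × ℕ) → List ℕ
  rimCountsFrom : ℕ → ℕ → List (ℕ × ℕ) → List ℕ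

  rimCounts []            = []
  rimCounts ((l , a) ∷ B) = rimCountsFrom l a B

  rimCountsFrom l a [] with p ≤? (a ∸ 1) + l
  ... | yes _ = replicate (a ∸ 1) 1 ++ (p ∸ (a ∸ 1)) ∷ []
  ... | no  _ = replicate (a ∸ 1) 1 ++ l ∷ []
  rimCountsFrom l a ((l′ , a′) ∷ B) with p ≤? a + (l ∸ l′)
  ... | yes _ = replicate (a ∸ 1) 1 ++ (p ∸ (a ∸ 1)) ∷ rimCountsFrom l′ a′ B
  ... | no  _ = replicate (a ∸ 1) 1 ++ suc (l ∸ l′) ∷ replicate (a′ ∸ 1) 1 ++ 1 ∷ rimCounts B

  rimRemoved : List (ℕ × ℕ) → List (ℕ × ℕ)
  rimRemovedFrom : ℕ → ℕ → List (ℕ × ℕ) → List (ℕ × ℕ)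

  rimRemoved []            = []
  rimRemoved ((l , a) ∷ B) = rimRemovedFrom l a B

  rimRemovedFrom l a [] with p ≤? (a ∸ 1) + l
  ... | yes _ = (l ∸ 1 , a ∸ 1) ∷ (l ∸ (p ∸ (a ∸ 1)) , 1) ∷ []
  ... | no  _ = (l ∸ 1 , a ∸ 1) ∷ (0 , 1) ∷ []
  rimRemovedFrom l a ((l′ , a′) ∷ B) with p ≤? a + (l ∸ l′)
  ... | yes _ = (l ∸ 1 , a ∸ 1) ∷ (l ∸ (p ∸ (a ∸ 1)) , 1) ∷ rimRemovedFrom l′ a′ B
  ... | no  _ = (l ∸ 1 , a ∸ 1) ∷ (l′ ∸ 1 , suc a′) ∷ rimRemoved B

  JS-pair : ∀ {g u l₀ a₀ l₀′ a₀′ B} →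
    JSBlocks g u ((suc l₀ , suc a₀) ∷ (suc l₀′ , suc a₀′) ∷ B) → p ∣ suc a₀ + (l₀ ∸ l₀′) + suc a₀′
  JS-pair {g} {l₀ = l₀} {a₀} (cons _ _ _ _ type (cons l′<l _ _ _ type′ _)) =
    HasType⇒JS {g} {suc l₀} {suc a₀} (ℕP.<⇒≤ l′<l) type type′

  segment-spans-pair : ∀ {g u l₀ a₀ l₀′ a₀′ B} →
    JSBlocks g u ((suc l₀ , suc a₀) ∷ (suc l₀′ , suc a₀′) ∷ B) →
    ¬ p ≤ suc a₀ + (l₀ ∸ l₀′) → suc a₀ + (l₀ ∸ l₀′) + suc a₀′ ≡ p
  segment-spans-pair bs@(cons _ _ _ _ _ (cons _ _ _ a′<p _ _)) p≰ =
    multiple<double⇒≡ (JS-pair bs) (s≤s z≤n) (ℕP.+-mono-< (ℕP.≰⇒> p≰) a′<p)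

  segment-overshoots : ∀ {g u l₀ a₀ l₀′ a₀′ B} →
    JSBlocks g u ((suc l₀ , suc a₀) ∷ (suc l₀′ , suc a₀′) ∷ B) →
    p ≤ suc a₀ + (l₀ ∸ l₀′) → p ∸ a₀ ≤ l₀ ∸ l₀′
  segment-overshoots {a₀ = a₀} {a₀′ = a₀′} bs@(cons _ _ _ _ _ (cons _ _ _ a′<p _ _)) p≤
    with ℕP.m≤n⇒m<n∨m≡n p≤
  ... | inj₁ p< = ℕP.m≤n+o⇒m∸n≤o p a₀ (ℕP.≤-pred p<)
  ... | inj₂ p≡ =
    ⊥-elim (0<n<m⇒m∤n (s≤s z≤n) a′<p
      (∣m+n∣m⇒∣n (subst (λ n → p ∣ n + suc a₀′) (sym p≡) (JS-pair bs)) ∣-refl))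

  split-row-above-next : ∀ {g u l₀ a₀ l₀′ a₀′ B} →
    JSBlocks g u ((suc l₀ , suc a₀) ∷ (suc l₀′ , suc a₀′) ∷ B) →
    p ≤ suc a₀ + (l₀ ∸ l₀′) → suc l₀′ ≤ suc l₀ ∸ (p ∸ a₀)
  split-row-above-next {l₀ = l₀} {a₀} {l₀′} bs@(cons _ _ _ _ _ (cons l′<l _ _ _ _ _)) p≤ =
    ℕP.m+n≤o⇒m≤o∸n (suc l₀′) (ℕP.≤-trans (ℕP.+-monoʳ-≤ (suc l₀′) (segment-overshoots bs p≤))
                                          (s≤s (ℕP.≤-reflexive (ℕP.m+[n∸m]≡n (ℕP.≤-pred (ℕP.<⇒≤ l′<l))))))

  segCounts-blocks : ∀ {g u B} → JSBlocks g u B → segCounts p p (parts B) ≡ rimCounts B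
  segCounts-blocksFrom : ∀ {g u l a B} → JSBlocks g u ((l , a) ∷ B) →
    segCounts p p (parts ((l , a) ∷ B)) ≡ rimCountsFrom l a B

  segCounts-blocks []                  = refl
  segCounts-blocks bs@(cons _ _ _ _ _ _) = segCounts-blocksFrom bs

  segCounts-blocksFrom {l = suc l₀} {suc a₀} {[]} (cons _ (s≤s z≤n) (s≤s z≤n) a<p _ _) with p ≤? a₀ + suc l₀
  ... | yes ends =
    trans (segCounts-replicate p a₀ l₀ [] (ℕP.<⇒≤ a<p))
          (cong (replicate a₀ 1 ++_) (segCounts-fits p (suc l₀) [] (ℕP.m≤n+o⇒m∸n≤o p a₀ ends)))
  ... | no spills =
    trans (segCounts-replicate p a₀ l₀ [] (ℕP.<⇒≤ a<p))
          (cong (replicate a₀ 1 ++_) (segCounts-spills p (suc l₀) [] (spills ∘ m∸n≤o⇒m≤n+o a₀)))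
  segCounts-blocksFrom {l = suc l₀} {suc a₀} {(suc l₀′ , suc a₀′) ∷ B}
    bs@(cons _ (s≤s z≤n) (s≤s z≤n) a<p _ bs′@(cons _ (s≤s z≤n) (s≤s z≤n) _ _ bs″))
    with p ≤? suc a₀ + (l₀ ∸ l₀′)
  ... | yes ends =
    trans (segCounts-replicate p a₀ l₀ rows′ (ℕP.<⇒≤ a<p))
          (cong (replicate a₀ 1 ++_)
                (trans (segCounts-fits p (suc l₀) rows′
                         (ℕP.m≤n+o⇒m∸n≤o p a₀ (subst (p ≤_) (sym (ℕP.+-suc a₀ d)) ends)))
                       (cong ((p ∸ a₀) ∷_) (segCounts-blocksFrom bs′))))
    where
    d : ℕ
    d = l₀ ∸ l₀′
    rows′ : List ℕ
    rows′ = parts ((suc l₀′ , suc a₀′) ∷ B)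
  ... | no spans =
    trans (segCounts-replicate p a₀ l₀ rows′ (ℕP.<⇒≤ a<p)) (cong (replicate a₀ 1 ++_) (begin
      segCounts p (p ∸ a₀) (suc l₀ ∷ rows′)
        ≡⟨ segCounts-spills p (suc l₀) rows′ (spans ∘ subst (p ≤_) (ℕP.+-suc a₀ d) ∘ m∸n≤o⇒m≤n+o a₀) ⟩
      suc d ∷ segCounts p (p ∸ a₀ ∸ suc d) rows′
        ≡⟨ cong (λ b → suc d ∷ segCounts p b rows′) budget-left ⟩
      suc d ∷ segCounts p (suc a₀′) rows′
        ≡⟨ cong (suc d ∷_) (segCounts-replicate-exact p a₀′ l₀′ (parts B)) ⟩
      suc d ∷ replicate a₀′ 1 ++ 1 ∷ segCounts p p (parts B)
        ≡⟨ cong (λ cs → suc d ∷ replicate a₀′ 1 ++ 1 ∷ cs) (segCounts-blocks bs″) ⟩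
      suc d ∷ replicate a₀′ 1 ++ 1 ∷ rimCounts B ∎))
    where
    open ≡-Reasoning
    d : ℕ
    d = l₀ ∸ l₀′
    rows′ : List ℕ
    rows′ = parts ((suc l₀′ , suc a₀′) ∷ B)
    budget-left : p ∸ a₀ ∸ suc d ≡ suc a₀′
    budget-left = trans (ℕP.∸-+-assoc p a₀ (suc d))
      (m+n≡o⇒o∸m≡n (a₀ + suc d) (trans (cong (_+ suc a₀′) (ℕP.+-suc a₀ d)) (segment-spans-pair bs spans)))

  zipWith-blocks : ∀ {g u B} → JSBlocks g u B → zipWith _∸_ (parts B) (rimCounts B) ≡ parts (rimRemoved B)
  zipWith-blocksFrom : ∀ {g u l a B} → JSBlocks g u ((l , a) ∷ B) →
    zipWith _∸_ (parts ((l , a) ∷ B)) (rimCountsFrom l a B) ≡ parts (rimRemovedFrom l a B)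

  zipWith-blocks []                    = refl
  zipWith-blocks bs@(cons _ _ _ _ _ _) = zipWith-blocksFrom bs

  zipWith-blocksFrom {l = suc l₀} {suc a₀} {[]} (cons _ (s≤s z≤n) (s≤s z≤n) _ _ _) with p ≤? a₀ + suc l₀
  ... | yes _ = zipWith-∸-replicate a₀ (suc l₀) (p ∸ a₀) [] []
  ... | no  _ = trans (zipWith-∸-replicate a₀ (suc l₀) (suc l₀) [] [])
                      (cong (λ r → replicate a₀ l₀ ++ r ∷ []) (ℕP.n∸n≡0 l₀))
  zipWith-blocksFrom {l = suc l₀} {suc a₀} {(suc l₀′ , suc a₀′) ∷ B}
    (cons _ (s≤s z≤n) (s≤s z≤n) _ _ bs′@(cons l′<l (s≤s z≤n) (s≤s z≤n) _ _ bs″))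
    with p ≤? suc a₀ + (l₀ ∸ l₀′)
  ... | yes _ =
    trans (zipWith-∸-replicate a₀ (suc l₀) (p ∸ a₀) _ _)
          (cong (λ rs → replicate a₀ l₀ ++ (suc l₀ ∸ (p ∸ a₀)) ∷ rs) (zipWith-blocksFrom bs′))
  ... | no _ = begin
    zipWith _∸_ (replicate (suc a₀) (suc l₀) ++ replicate (suc a₀′) (suc l₀′) ++ parts B)
                (replicate a₀ 1 ++ suc (l₀ ∸ l₀′) ∷ replicate a₀′ 1 ++ 1 ∷ rimCounts B)
      ≡⟨ zipWith-∸-replicate a₀ (suc l₀) (suc (l₀ ∸ l₀′)) _ _ ⟩
    replicate a₀ l₀ ++ (l₀ ∸ (l₀ ∸ l₀′)) ∷ zipWith _∸_ (replicate (suc a₀′) (suc l₀′) ++ parts B)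
                                                       (replicate a₀′ 1 ++ 1 ∷ rimCounts B)
      ≡⟨ cong₂ (λ r rs → replicate a₀ l₀ ++ r ∷ rs) (ℕP.m∸[m∸n]≡n (ℕP.≤-pred (ℕP.<⇒≤ l′<l)))
               (zipWith-∸-replicate a₀′ (suc l₀′) 1 (parts B) (rimCounts B)) ⟩
    replicate a₀ l₀ ++ l₀′ ∷ replicate a₀′ l₀′ ++ l₀′ ∷ zipWith _∸_ (parts B) (rimCounts B)
      ≡⟨ cong (λ rs → replicate a₀ l₀ ++ l₀′ ∷ rs)
              (trans (replicate-++-∷ a₀′ l₀′ _)
                     (cong (λ rs → l₀′ ∷ replicate a₀′ l₀′ ++ rs) (zipWith-blocks bs″))) ⟩
    replicate a₀ l₀ ++ l₀′ ∷ l₀′ ∷ replicate a₀′ l₀′ ++ parts (rimRemoved B) ∎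
    where open ≡-Reasoning

  removePRim-blocks : ∀ {g u B} → JSBlocks g u B → removePRim p (parts B) ≡ parts (dropEmpty (rimRemoved B))
  removePRim-blocks {B = B} bs = begin
    filter (1 ≤?_) (zipWith _∸_ (parts B) (segCounts p p (parts B)))
      ≡⟨ cong (λ cs → filter (1 ≤?_) (zipWith _∸_ (parts B) cs)) (segCounts-blocks bs) ⟩
    filter (1 ≤?_) (zipWith _∸_ (parts B) (rimCounts B))
      ≡⟨ cong (filter (1 ≤?_)) (zipWith-blocks bs) ⟩
    filter (1 ≤?_) (parts (rimRemoved B))
      ≡⟨ filter-parts (rimRemoved B) ⟩
    parts (dropEmpty (rimRemoved B)) ∎
    where open ≡-Reasoning

  rimRemoved-weak : ∀ {g u B u′} → JSBlocks g u B → headLength B ≤ u′ → WeakJSBlocks g u′ (rimRemoved B)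
  rimRemovedFrom-weak : ∀ {g u l a B u′} → JSBlocks g u ((l , a) ∷ B) → l ≤ u′ →
    WeakJSBlocks g u′ (rimRemovedFrom l a B)

  rimRemoved-weak []                     _    = []
  rimRemoved-weak bs@(cons _ _ _ _ _ _) l≤u′ = rimRemovedFrom-weak bs l≤u′

  rimRemovedFrom-weak {g} {l = suc l₀} {suc a₀} {[]} (cons _ (s≤s z≤n) (s≤s z≤n) a<p type _) l≤u′
    with p ≤? a₀ + suc l₀
  ... | yes ends =
    cons (inj₁ l≤u′) (λ _ → ℕP.<⇒≤ a<p , HasType-shrink {g} {l₀} {a₀} type)
      (cons ([1+m]∸n<m⊎≡0 l₀ (ℕP.m+n≤o⇒m≤o∸n 2 a<p))
            (λ _ → 2≤p , HasType-split {g} {l₀} {a₀} (ℕP.<⇒≤ (ℕP.<⇒≤ a<p)) (ℕP.m≤n+o⇒m∸n≤o p a₀ ends) type)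
            [])
  ... | no _ =
    cons (inj₁ l≤u′) (λ _ → ℕP.<⇒≤ a<p , HasType-shrink {g} {l₀} {a₀} type) (cons (inj₂ refl) (λ ()) [])
  rimRemovedFrom-weak {g} {l = suc l₀} {suc a₀} {(suc l₀′ , suc a₀′) ∷ B}
    bs@(cons _ (s≤s z≤n) (s≤s z≤n) a<p type bs′@(cons l′<l (s≤s z≤n) (s≤s z≤n) _ type′ bs″)) l≤u′
    with p ≤? suc a₀ + (l₀ ∸ l₀′)
  ... | yes ends =
    cons (inj₁ l≤u′) (λ _ → ℕP.<⇒≤ a<p , HasType-shrink {g} {l₀} {a₀} type)
      (cons ([1+m]∸n<m⊎≡0 l₀ (ℕP.m+n≤o⇒m≤o∸n 2 a<p))
            (λ _ → 2≤p , HasType-split {g} {l₀} {a₀} (ℕP.<⇒≤ (ℕP.<⇒≤ a<p)) c≤l type)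
        (subst (λ h → WeakJSBlocks h (suc l₀ ∸ (p ∸ a₀)) (rimRemovedFrom (suc l₀′) (suc a₀′) B))
               (trans (ℕP.+-suc g a₀) (ℕP.+-comm 1 (g + a₀)))
               (rimRemovedFrom-weak bs′ (split-row-above-next bs ends))))
    where
    c≤l : p ∸ a₀ ≤ suc l₀
    c≤l = ℕP.≤-trans (segment-overshoots bs ends) (ℕP.≤-trans (ℕP.m∸n≤m l₀ l₀′) (ℕP.n≤1+n l₀))
  ... | no spans =
    cons (inj₁ l≤u′) (λ _ → ℕP.<⇒≤ a<p , HasType-shrink {g} {l₀} {a₀} type)
      (cons (inj₁ (ℕP.≤-pred l′<l)) (λ _ → a′+2<p , HasType-merge {g} {a₀} {l₀′} {a₀′} type′)
        (subst (λ h → WeakJSBlocks h l₀′ (rimRemoved B)) (regroup g a₀ a₀′)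
               (rimRemoved-weak bs″ (headLength< bs″))))
    where
    regroup : ∀ g a a′ → g + suc a + suc a′ ≡ g + a + suc (suc a′)
    regroup = ℕRing.solve-∀
    a′+2<p : suc (suc a₀′) < p
    a′+2<p = subst (suc (suc a₀′) <_) (segment-spans-pair bs spans)
      (ℕP.+-monoˡ-≤ (suc a₀′)
        (s≤s (ℕP.≤-trans (ℕP.m<n⇒0<n∸m (ℕP.≤-pred l′<l)) (ℕP.m≤n+m (l₀ ∸ l₀′) a₀))))

  rimStep-split-last : ∀ {g l₀ a₀} → suc a₀ < p → HasType g (suc l₀) (suc a₀) → p ≤ a₀ + suc l₀ →
    RimStep (g + (suc a₀ + 0)) (g + rows (dropEmpty ((l₀ , a₀) ∷ (suc l₀ ∸ (p ∸ a₀) , 1) ∷ [])))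
            (sum (replicate a₀ 1 ++ (p ∸ a₀) ∷ []))
  rimStep-split-last {l₀ = zero} {a₀} a<p _ ends = ⊥-elim (ℕP.<⇒≱ a<p (subst (p ≤_) (ℕP.+-comm a₀ 1) ends))
  rimStep-split-last {g} {suc l₁} {a₀} a<p type ends =
    RimStep-cong refl (cong (λ r → g + r) (sym (rows-dropEmpty a₀ _ (s≤s z≤n)))) (sym size≡p)
                 (by-split-row (suc (suc l₁) ∸ (p ∸ a₀)) refl)
    where
    a≤p : a₀ ≤ p
    a≤p = ℕP.<⇒≤ (ℕP.<⇒≤ a<p)
    size≡p : sum (replicate a₀ 1 ++ (p ∸ a₀) ∷ []) ≡ p
    size≡p = trans (sum-ones-++ a₀ _) (trans (cong (λ n → a₀ + n) (ℕP.+-identityʳ (p ∸ a₀))) (ℕP.m+[n∸m]≡n a≤p))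
    by-split-row : ∀ m → suc (suc l₁) ∸ (p ∸ a₀) ≡ m →
      RimStep (g + (suc a₀ + 0)) (g + (a₀ + rows (dropEmpty ((m , 1) ∷ [])))) p
    by-split-row (suc _) _ = p∣size ∣-refl (∼-reflexive (cong +_ (same-rows g a₀)))
      where
      same-rows : ∀ g a → g + (suc a + 0) ≡ g + (a + 1)
      same-rows = ℕRing.solve-∀
    by-split-row zero m≡0 = p∣size ∣-refl (mirrored (p∣-diff (pair-rows (+ g) (+ a₀) (+ p) α) p∣p type′))
      where
      l≡p-a : + suc (suc l₁) ≡ + p ℤ.- + a₀
      l≡p-a = trans (cong +_ (ℕP.≤-antisym (ℕP.m∸n≡0⇒m≤n m≡0) (ℕP.m≤n+o⇒m∸n≤o p a₀ ends))) (pos-∸ a≤p)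
      type′ : p∣ (((+ p ℤ.- + a₀) ℤ.- + suc a₀ ℤ.- (+ g ℤ.+ + g)) ℤ.- α)
      type′ = subst (λ l → p∣ ((l ℤ.- + suc a₀ ℤ.- (+ g ℤ.+ + g)) ℤ.- α)) l≡p-a type
      pair-rows : ∀ g a p α → ((g ℤ.+ ((+ 1 ℤ.+ a) ℤ.+ + 0)) ℤ.+ (g ℤ.+ (a ℤ.+ + 0))) ℤ.- ℤ.- α ≡
        p ℤ.- (((p ℤ.- a) ℤ.- (+ 1 ℤ.+ a) ℤ.- (g ℤ.+ g)) ℤ.- α)
      pair-rows = solve-∀

  rimStep-whole-last : ∀ {g l₀ a₀} → HasType g (suc l₀) (suc a₀) → ¬ p ≤ a₀ + suc l₀ →
    RimStep (g + (suc a₀ + 0)) (g + rows (dropEmpty ((l₀ , a₀) ∷ (0 , 1) ∷ [])))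
            (sum (replicate a₀ 1 ++ suc l₀ ∷ []))
  rimStep-whole-last {g} {l₀} {a₀} type spills =
    RimStep-cong refl refl (sym (sum-ones-++ a₀ (suc l₀ ∷ [])))
      (p∤size (0<n<m⇒m∤n (ℕP.≤-trans (s≤s z≤n) (ℕP.m≤n+m (suc l₀ + 0) a₀)) size<p)
              (p∣-≡ (size (+ g) (+ a₀) (+ l₀) α) type)
              (by-length l₀ type))
    where
    size<p : a₀ + (suc l₀ + 0) < p
    size<p = subst (λ n → a₀ + n < p) (sym (ℕP.+-identityʳ (suc l₀))) (ℕP.≰⇒> spills)
    size : ∀ g a l α → (a ℤ.+ ((+ 1 ℤ.+ l) ℤ.+ + 0)) ℤ.-
        (α ℤ.+ (g ℤ.+ ((+ 1 ℤ.+ a) ℤ.+ + 0)) ℤ.+ (g ℤ.+ ((+ 1 ℤ.+ a) ℤ.+ + 0)) ℤ.- + 1) ≡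
      ((+ 1 ℤ.+ l) ℤ.- (+ 1 ℤ.+ a) ℤ.- (g ℤ.+ g)) ℤ.- α
    size = solve-∀
    by-length : ∀ l₀ → HasType g (suc l₀) (suc a₀) →
      + (g + (suc a₀ + 0)) ℤ.- + 1 ∼ + (g + rows (dropEmpty ((l₀ , a₀) ∷ (0 , 1) ∷ [])))
    by-length zero type = mirrored (p∣-neg (pair-rows (+ g) (+ a₀) α) type)
      where
      pair-rows : ∀ g a α → ((g ℤ.+ ((+ 1 ℤ.+ a) ℤ.+ + 0)) ℤ.- + 1 ℤ.+ (g ℤ.+ + 0)) ℤ.- ℤ.- α ≡
        ℤ.- (((+ 1 ℤ.+ + 0) ℤ.- (+ 1 ℤ.+ a) ℤ.- (g ℤ.+ g)) ℤ.- α)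
      pair-rows = solve-∀
    by-length (suc _) _ =
      subst (λ r → _ ∼ + (g + r)) (sym (rows-dropEmpty a₀ ((0 , 1) ∷ []) (s≤s z≤n)))
            (∼-reflexive (one-less (+ g) (+ a₀)))
      where
      one-less : ∀ g a → (g ℤ.+ ((+ 1 ℤ.+ a) ℤ.+ + 0)) ℤ.- + 1 ≡ g ℤ.+ (a ℤ.+ (+ 0 ℤ.+ + 0))
      one-less = solve-∀

  rimStep-pair-last : ∀ {g l₀ a₀ a₀′} → 1 ≤ l₀ → suc a₀ + (l₀ ∸ 0) + suc a₀′ ≡ p →
    HasType (g + suc a₀) 1 (suc a₀′) →
    RimStep (g + (suc a₀ + (suc a₀′ + 0))) (g + rows (dropEmpty ((l₀ , a₀) ∷ (0 , suc (suc a₀′)) ∷ [])))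
            (sum (replicate a₀ 1 ++ suc (l₀ ∸ 0) ∷ replicate a₀′ 1 ++ 1 ∷ []))
  rimStep-pair-last {g} {l₀} {a₀} {a₀′} 1≤l spanned type′ =
    RimStep-cong refl (cong (λ r → g + r) (sym (rows-dropEmpty a₀ ((0 , suc (suc a₀′)) ∷ []) 1≤l))) (sym size≡p)
      (p∣size ∣-refl (mirrored (p∣-neg (pair-rows (+ g) (+ a₀) (+ a₀′) α) type′)))
    where
    size≡p : sum (replicate a₀ 1 ++ suc (l₀ ∸ 0) ∷ replicate a₀′ 1 ++ 1 ∷ []) ≡ p
    size≡p = trans (sum-ones-++ a₀ _) (trans (cong (λ s → a₀ + (suc (l₀ ∸ 0) + s)) (sum-ones-++ a₀′ (1 ∷ [])))
               (trans (regroup a₀ (l₀ ∸ 0) a₀′) spanned))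
      where
      regroup : ∀ a d a′ → a + (suc d + (a′ + (1 + 0))) ≡ suc a + d + suc a′
      regroup = ℕRing.solve-∀
    pair-rows : ∀ g a a′ α →
      ((g ℤ.+ ((+ 1 ℤ.+ a) ℤ.+ ((+ 1 ℤ.+ a′) ℤ.+ + 0))) ℤ.+ (g ℤ.+ (a ℤ.+ + 0))) ℤ.- ℤ.- α ≡
      ℤ.- (((+ 1 ℤ.+ + 0) ℤ.- (+ 1 ℤ.+ a′) ℤ.- ((g ℤ.+ (+ 1 ℤ.+ a)) ℤ.+ (g ℤ.+ (+ 1 ℤ.+ a)))) ℤ.- α)
    pair-rows = solve-∀

  rimStep : ∀ {g u B} → JSBlocks g u B →
    RimStep (g + rows B) (g + rows (dropEmpty (rimRemoved B))) (sum (rimCounts B))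
  rimStepFrom : ∀ {g u l a B} → JSBlocks g u ((l , a) ∷ B) →
    RimStep (g + rows ((l , a) ∷ B)) (g + rows (dropEmpty (rimRemovedFrom l a B))) (sum (rimCountsFrom l a B))
  rimStep-pair : ∀ {g u l₀ a₀ l₀′ a₀′ B} →
    JSBlocks g u ((suc l₀ , suc a₀) ∷ (suc l₀′ , suc a₀′) ∷ B) →
    suc a₀ + (l₀ ∸ l₀′) + suc a₀′ ≡ p →
    RimStep (g + rows ((suc l₀ , suc a₀) ∷ (suc l₀′ , suc a₀′) ∷ B))
            (g + rows (dropEmpty ((l₀ , a₀) ∷ (l₀′ , suc (suc a₀′)) ∷ rimRemoved B)))
            (sum (replicate a₀ 1 ++ suc (l₀ ∸ l₀′) ∷ replicate a₀′ 1 ++ 1 ∷ rimCounts B))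

  rimStep []                     = p∣size (divides 0 refl) (∼-reflexive refl)
  rimStep bs@(cons _ _ _ _ _ _) = rimStepFrom bs

  rimStepFrom {l = suc l₀} {suc a₀} {[]} (cons _ (s≤s z≤n) (s≤s z≤n) a<p type _) with p ≤? a₀ + suc l₀
  ... | yes ends   = rimStep-split-last a<p type ends
  ... | no  spills = rimStep-whole-last type spills
  rimStepFrom {g} {l = suc l₀} {suc a₀} {(suc l₀′ , suc a₀′) ∷ B}
    bs@(cons _ (s≤s z≤n) (s≤s z≤n) a<p _ bs′@(cons l′<l (s≤s z≤n) (s≤s z≤n) _ _ _))
    with p ≤? suc a₀ + (l₀ ∸ l₀′)
  ... | no spans = rimStep-pair bs (segment-spans-pair bs spans)
  ... | yes ends =
    RimStep-cong (ℕP.+-assoc g (suc a₀) _) rows-after size (RimStep-+p (rimStepFrom bs′))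
    where
    m : ℕ
    m = suc l₀ ∸ (p ∸ a₀)
    Y : List (ℕ × ℕ)
    Y = rimRemovedFrom (suc l₀′) (suc a₀′) B
    S : ℕ
    S = sum (rimCountsFrom (suc l₀′) (suc a₀′) B)
    regroup : ∀ g a z → g + suc a + z ≡ g + (a + (1 + z))
    regroup = ℕRing.solve-∀
    rows-after : g + suc a₀ + rows (dropEmpty Y) ≡ g + rows (dropEmpty ((l₀ , a₀) ∷ (m , 1) ∷ Y))
    rows-after = trans (regroup g a₀ _) (cong (λ r → g + r) (sym
      (trans (rows-dropEmpty a₀ _ (ℕP.≤-trans (s≤s z≤n) (ℕP.≤-pred l′<l)))
             (cong (λ r → a₀ + r) (rows-dropEmpty 1 Y (ℕP.≤-trans (s≤s z≤n) (split-row-above-next bs ends)))))))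
    size : p + S ≡ sum (replicate a₀ 1 ++ (p ∸ a₀) ∷ rimCountsFrom (suc l₀′) (suc a₀′) B)
    size = sym (trans (sum-ones-++ a₀ _) (trans (sym (ℕP.+-assoc a₀ (p ∸ a₀) S))
                  (cong (_+ S) (ℕP.m+[n∸m]≡n (ℕP.<⇒≤ (ℕP.<⇒≤ a<p))))))

  rimStep-pair {l₀′ = zero} {B = []} (cons _ _ _ _ _ (cons l′<l _ _ _ type′ _)) spanned =
    rimStep-pair-last (ℕP.≤-pred l′<l) spanned type′
  rimStep-pair {l₀′ = zero} {B = _ ∷ _} (cons _ _ _ _ _ (cons _ _ _ _ _ (cons l<1 1≤l _ _ _ _))) _ =
    ⊥-elim (ℕP.<⇒≱ l<1 1≤l)
  rimStep-pair {g} {l₀ = l₀} {a₀} {suc l₁′} {a₀′} {B} (cons _ _ _ _ _ (cons l′<l _ _ _ _ bs″)) spanned =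
    RimStep-cong (regroup-rows g a₀ a₀′ _) rows-after size (RimStep-+p (rimStep bs″))
    where
    Z : ℕ
    Z = rows (dropEmpty (rimRemoved B))
    S : ℕ
    S = sum (rimCounts B)
    regroup-rows : ∀ g a a′ r → g + suc a + suc a′ + r ≡ g + (suc a + (suc a′ + r))
    regroup-rows = ℕRing.solve-∀
    regroup-rows′ : ∀ g a a′ z → g + suc a + suc a′ + z ≡ g + (a + (suc (suc a′) + z))
    regroup-rows′ = ℕRing.solve-∀
    rows-after : g + suc a₀ + suc a₀′ + Z ≡
      g + rows (dropEmpty ((l₀ , a₀) ∷ (suc l₁′ , suc (suc a₀′)) ∷ rimRemoved B))
    rows-after = trans (regroup-rows′ g a₀ a₀′ Z)
      (cong (λ r → g + r) (sym (rows-dropEmpty a₀ _ (ℕP.≤-trans (s≤s z≤n) (ℕP.≤-pred l′<l)))))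
    regroup-size : ∀ a d a′ s → a + (suc d + (a′ + (1 + s))) ≡ suc a + d + suc a′ + s
    regroup-size = ℕRing.solve-∀
    size : p + S ≡ sum (replicate a₀ 1 ++ suc (l₀ ∸ suc l₁′) ∷ replicate a₀′ 1 ++ 1 ∷ rimCounts B)
    size = sym (trans (sum-ones-++ a₀ _) (trans (cong (λ s → a₀ + (suc (l₀ ∸ suc l₁′) + s)) (sum-ones-++ a₀′ _))
             (trans (regroup-size a₀ (l₀ ∸ suc l₁′) a₀′ S) (cong (_+ S) spanned))))

  residue-chain : ∀ n {u} B → JSBlocks 0 u B → sum (parts B) ≤ n →
    ChainUpTo (map residueColumn (reverse (mullineuxPairs n p (parts B)))) (length (parts B))
  residue-chain zero    [] _ _ = chainUpTo [] (∼-reflexive refl)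
  residue-chain (suc n) [] _ _ = chainUpTo [] (∼-reflexive refl)
  residue-chain zero    ((suc _ , suc _) ∷ _) (cons _ (s≤s z≤n) (s≤s z≤n) _ _ _) ()
  residue-chain (suc n) {u} B₀@((suc l₀ , suc a₀) ∷ B) bs@(cons l<u (s≤s z≤n) (s≤s z≤n) _ _ _) size≤ =
    subst (λ cs → ChainUpTo cs (length (parts B₀)))
          (sym (map-reverse-∷ residueColumn (pRimSize p (parts B₀) , length (parts B₀))
                                (mullineuxPairs n p (removePRim p (parts B₀)))))
          (chain-extend step rest)
    where
    B′ : List (ℕ × ℕ)
    B′ = dropEmpty (rimRemoved B₀)
    removal : removePRim p (parts B₀) ≡ parts B′
    removal = removePRim-blocks bs
    smaller : sum (parts B′) ≤ n
    smaller = ℕP.≤-pred (ℕP.≤-trans (subst (λ μ → sum μ < sum (parts B₀)) removal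
                (removePRim-shrinks p (ℕP.≤-trans (s≤s z≤n) 2≤p) (parts-positive bs))) size≤)
    rest : ChainUpTo (map residueColumn (reverse (mullineuxPairs n p (removePRim p (parts B₀))))) (length (parts B′))
    rest = subst (λ μ → ChainUpTo (map residueColumn (reverse (mullineuxPairs n p μ))) (length (parts B′)))
                 (sym removal)
                 (residue-chain n B′ (dropEmpty-JSBlocks (rimRemoved-weak bs (ℕP.<⇒≤ l<u))) smaller)
    step : RimStep (length (parts B₀)) (length (parts B′)) (pRimSize p (parts B₀))
    step = RimStep-cong (sym (length-parts B₀)) (sym (length-parts B′)) (sym (cong sum (segCounts-blocks bs)))
                        (rimStep bs)

corollary3p2 : (p : ℕ) → 2 ≤ p → (l₁ a₁ : ℕ) → (rest : List (ℕ × ℕ)) →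
    IsPartitionExp ((l₁ , a₁) ∷ rest) → IsJS p ((l₁ , a₁) ∷ rest) →
    ((l k : Fin (length (residueSymbol p (parts ((l₁ , a₁) ∷ rest))))) →
      l Fin.< k →
      Regular p (lookup (residueSymbol p (parts ((l₁ , a₁) ∷ rest))) l) →
      Regular p (lookup (residueSymbol p (parts ((l₁ , a₁) ∷ rest))) k) →
      ((i : Fin (length (residueSymbol p (parts ((l₁ , a₁) ∷ rest))))) → l Fin.< i → i Fin.< k →
        Singular p (lookup (residueSymbol p (parts ((l₁ , a₁) ∷ rest))) i)) →
      ((proj₁ (lookup (residueSymbol p (parts ((l₁ , a₁) ∷ rest))) k)
          ≡ jsType l₁ a₁ ℤ.+ + 1 ℤ.- proj₂ (lookup (residueSymbol p (parts ((l₁ , a₁) ∷ rest))) l) [mod p ]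
        × proj₂ (lookup (residueSymbol p (parts ((l₁ , a₁) ∷ rest))) k)
          ≡ proj₂ (lookup (residueSymbol p (parts ((l₁ , a₁) ∷ rest))) l) ℤ.- + 1 [mod p ]
        × proj₁ (lookup (residueSymbol p (parts ((l₁ , a₁) ∷ rest))) k)
          ≡ proj₁ (lookup (residueSymbol p (parts ((l₁ , a₁) ∷ rest))) l) ℤ.+ + 1 [mod p ]
        × proj₂ (lookup (residueSymbol p (parts ((l₁ , a₁) ∷ rest))) k)
          ≡ jsType l₁ a₁ ℤ.- (proj₁ (lookup (residueSymbol p (parts ((l₁ , a₁) ∷ rest))) l) ℤ.+ + 1) [mod p ])
      ⊎ (proj₁ (lookup (residueSymbol p (parts ((l₁ , a₁) ∷ rest))) k)
          ≡ proj₂ (lookup (residueSymbol p (parts ((l₁ , a₁) ∷ rest))) l) ℤ.- + 1 [mod p ]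
        × proj₂ (lookup (residueSymbol p (parts ((l₁ , a₁) ∷ rest))) k)
          ≡ jsType l₁ a₁ ℤ.+ + 1 ℤ.- proj₂ (lookup (residueSymbol p (parts ((l₁ , a₁) ∷ rest))) l) [mod p ])))
    ×
    ((k : Fin (length (residueSymbol p (parts ((l₁ , a₁) ∷ rest))))) →
      0 ℕ.< toℕ k →
      ((i : Fin (length (residueSymbol p (parts ((l₁ , a₁) ∷ rest))))) → i Fin.< k →
        Singular p (lookup (residueSymbol p (parts ((l₁ , a₁) ∷ rest))) i)) →
      Regular p (lookup (residueSymbol p (parts ((l₁ , a₁) ∷ rest))) k) →
      ((proj₁ (lookup (residueSymbol p (parts ((l₁ , a₁) ∷ rest))) k) ≡ jsType l₁ a₁ [mod p ]
        × proj₂ (lookup (residueSymbol p (parts ((l₁ , a₁) ∷ rest))) k) ≡ + 0 [mod p ])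
      ⊎ (proj₁ (lookup (residueSymbol p (parts ((l₁ , a₁) ∷ rest))) k) ≡ + 0 [mod p ]
        × proj₂ (lookup (residueSymbol p (parts ((l₁ , a₁) ∷ rest))) k) ≡ jsType l₁ a₁ [mod p ])))
corollary3p2 p 2≤p l₁ a₁ rest shape js =
    (λ l k l<k regular-l regular-k between →
       consecutive-regular (lookup symbol l) (lookup symbol k) (regular-column-sum chain l regular-l)
                           (next-regular-follows chain l k l<k regular-l regular-k between))
  , (λ k _ before regular-k → first-regular (lookup symbol k) (first-regular-follows chain k before regular-k))
  where
  open Congruence p
  open ResidueChains p (jsType l₁ a₁)
  open RimOfJSBlocks p 2≤p (jsType l₁ a₁)

  blocks : List (ℕ × ℕ)
  blocks = (l₁ , a₁) ∷ rest

  symbol : List (ℤ × ℤ)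
  symbol = residueSymbol p (parts blocks)

  symbol-chain : ChainUpTo symbol (length (parts blocks))
  symbol-chain =
    residue-chain (sum (parts blocks)) blocks (JSBlocks-ofJS shape js (≋-reflexive {+ l₁ ℤ.- + a₁} refl)) ℕP.≤-refl

  chain : Chain (+ 1) symbol (ChainUpTo.lastY symbol-chain)
  chain = ChainUpTo.chain symbol-chain
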